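{- Let $n,t$ be positive integers. The set of $312$-avoiding permutations $w\in\mathfrak S_{tn}$ such that $w_k$ is a multiple of $t$ for every ascent $k$ of $w$ is in bijection with the set of $t$-Dyck paths ending at $(tn,tn)$.
   Context: A permutation $w$ is $312$-avoiding if there are no $i<j<k$ with $w_j<w_k<w_i$; $k$ is an ascent of $w$ if $w_{k-1}<w_k$, and $1$ is always an ascent. A $t$-Dyck path (of length $tn$) is a lattice path with nodes $(x_i,y_i)_{i=0}^{(t+1)n}$ in $\mathbb N\times\mathbb N$ such that $(x_0,y_0)=(0,0)$, $(x_{(t+1)n},y_{(t+1)n})=(tn,tn)$, $x_i\le y_i$ for all $i$, and each step $(x_{i+1},y_{i+1})-(x_i,y_i)$ is either $(1,0)$ or $(0,t)$. -}

module Defs where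

open import Data.Bool using (Bool; true; false; _∧_; _∨_; not; if_then_else_; T)
open import Data.Nat using (ℕ; zero; suc; _+_; _*_; _≤ᵇ_; _<ᵇ_; _≡ᵇ_)
open import Data.Nat.Divisibility using (_∣?_)
open import Data.Fin using (Fin; toℕ)
open import Data.Vec using (Vec; toList)
open import Data.List using (List; []; _∷_; map)
open import Data.Bool.ListAction using (any)
open import Data.Product using (Σ)
open import Relation.Nullary.Decidable using (⌊_⌋)

-- A word is a vector w : Vec (Fin N) N; its k-th letter has value
-- suc (toℕ w_k) ∈ {1,…,N}.  It is a permutation iff its letters are
-- pairwise distinct.  All predicates are Bool-valued so that the
-- subtypes below are proof-irrelevant (T b is ⊤ or ⊥).

values : {N : ℕ} → Vec (Fin N) N → List ℕ
values w = map (λ i → suc (toℕ i)) (toList w)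

distinct : List ℕ → Bool
distinct []       = true
distinct (a ∷ xs) = not (any (λ b → a ≡ᵇ b) xs) ∧ distinct xs

pairs312 : ℕ → List ℕ → Bool
pairs312 a []       = false
pairs312 a (b ∷ ys) = any (λ c → (b <ᵇ c) ∧ (c <ᵇ a)) ys ∨ pairs312 a ys

contains312 : List ℕ → Bool
contains312 []       = false
contains312 (a ∷ xs) = pairs312 a xs ∨ contains312 xs

divides : ℕ → ℕ → Bool
divides t m = ⌊ t ∣? m ⌋

-- every ascent value is a multiple of t; position 1 is always an ascent,
-- position k > 1 is an ascent iff x_{k-1} < x_k.
ascentsRest : ℕ → ℕ → List ℕ → Bool
ascentsRest t prev []       = true
ascentsRest t prev (b ∷ ys) =
  (if prev <ᵇ b then divides t b else true) ∧ ascentsRest t b ys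

ascentsMultiple : ℕ → List ℕ → Bool
ascentsMultiple t []       = true
ascentsMultiple t (a ∷ xs) = divides t a ∧ ascentsRest t a xs

Perm312Asc : ℕ → ℕ → Set
Perm312Asc t n =
  Σ (Vec (Fin (t * n)) (t * n))
    (λ w → T (distinct (values w) ∧ not (contains312 (values w))
              ∧ ascentsMultiple t (values w)))

data Step : Set where
  east north : Step

walk : ℕ → ℕ → ℕ → ℕ → List Step → Bool
walk t N x y []            = (x ≤ᵇ y) ∧ (x ≡ᵇ N) ∧ (y ≡ᵇ N)
walk t N x y (east ∷ s)    = (x ≤ᵇ y) ∧ walk t N (suc x) y s
walk t N x y (north ∷ s)   = (x ≤ᵇ y) ∧ walk t N x (y + t) s

isTDyck : ℕ → ℕ → List Step → Bool
isTDyck t n s = walk t (t * n) 0 0 s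

TDyck : ℕ → ℕ → Set
TDyck t n = Σ (List Step) (λ s → T (isTDyck t n s))

{-# OPTIONS --safe #-}
-- Read a t-Dyck path as a stack program.  The state is the height M reached so far and the stack of the
-- values in [1, M] not yet written, in decreasing order: a north step raises M to M + t and pushes
-- M + t, …, M + 1, an east step pops the top value and writes it.  Every value is written exactly once,
-- and the word avoids 312 because a popped value exceeds everything still below it on the stack and is
-- smaller than every value pushed later.  At an ascent the value written was pushed after its
-- predecessor was written, so it is the top of a freshly pushed block, i.e. the current height, a
-- multiple of t.  Conversely, read such a permutation from left to right: a letter v above the current
-- maximum M is a multiple of t and is produced by (v − M)/t north steps and an east step; any other
-- letter must be the top s of the stack, for otherwise M, v, s would form a 312 pattern.
module Submission where

open import Data.Bool using (Bool; true; false; _∧_; _∨_; not; if_then_else_; T)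
open import Data.Bool.ListAction using (any)
open import Data.Bool.Properties using (T-∧; T-irrelevant)
open import Data.Empty using (⊥-elim)
open import Data.Fin using (Fin; toℕ; fromℕ<)
open import Data.Fin.Properties using (toℕ<n; toℕ-fromℕ<; toℕ-injective)
open import Data.List using (List; []; _∷_; _++_; length; replicate; map)
open import Data.List.Membership.Propositional using (_∈_)
open import Data.List.Membership.Propositional.Properties
  using (∈-++⁻; ∈-++⁺ˡ; ∈-++⁺ʳ; ∈-∃++; ∈-map⁻)
open import Data.List.Properties using (length-++; length-map; ++-assoc; map-injective)
open import Data.List.Relation.Binary.Subset.Propositional using (_⊆_)
open import Data.List.Relation.Unary.All using (All; []; _∷_)
import Data.List.Relation.Unary.All as All
import Data.List.Relation.Unary.All.Properties as All
open import Data.List.Relation.Unary.All.Properties using (¬Any⇒All¬; All¬⇒¬Any)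
open import Data.List.Relation.Unary.AllPairs using (AllPairs; []; _∷_)
import Data.List.Relation.Unary.AllPairs as AllPairs
import Data.List.Relation.Unary.AllPairs.Properties as AllPairs
open import Data.List.Relation.Unary.Any using (here; there)
import Data.List.Relation.Unary.Any as Any
open import Data.List.Relation.Unary.Any.Properties using (any⁺; any⁻)
open import Data.List.Relation.Unary.Linked using (Linked; [-]; _∷_)
import Data.List.Relation.Unary.Linked as Linked
open import Data.List.Relation.Unary.Unique.Propositional using (Unique)
open import Data.Nat
open import Data.Nat.DivMod using (_/_; m*n/n≡m)
open import Data.Nat.Divisibility
  using (_∣_; _∣0; ∣-refl; ∣m∣n⇒∣m+n; ∣m+n∣m⇒∣n) renaming (divides to mk∣)
open import Data.Nat.Properties
open import Data.Product using (Σ; ∃; _×_; _,_; proj₁; proj₂)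
open import Data.Product.Function.NonDependent.Propositional using (_×-⇔_)
open import Data.Sum using (_⊎_; inj₁; inj₂)
open import Data.Unit using (⊤; tt)
open import Data.Vec using (Vec; toList; cast)
import Data.Vec as Vec
open import Data.Vec.Properties using (toList-injective; toList-cast; length-toList)
open import Data.Vec.Relation.Binary.Equality.Cast using (cast-is-id)
open import Function using (_∘_)
open import Function.Bundles using (_⇔_; mk⇔; Equivalence; _⤖_; mk↔ₛ′)
import Function.Properties.Equivalence as ⇔
open import Function.Properties.Inverse using (↔⇒⤖)
open import Relation.Binary.Definitions using (DecidableEquality; tri<; tri≈; tri>)
open import Relation.Binary.PropositionalEquality
open import Relation.Nullary using (¬_; yes; no)
open import Relation.Nullary.Decidable using (toWitness; fromWitness)
open import Relation.Nullary.Reflects using (ofʸ; ofⁿ)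

open import Defs

open Equivalence using (to; from)

private variable
  A : Set

replicate-suc-++ : ∀ k (x : A) xs → replicate (suc k) x ++ xs ≡ replicate k x ++ x ∷ xs
replicate-suc-++ zero    x xs = refl
replicate-suc-++ (suc k) x xs = cong (x ∷_) (replicate-suc-++ k x xs)

length-++-∷ : ∀ (ys₁ : List A) {x ys₂} → length (ys₁ ++ x ∷ ys₂) ≡ suc (length (ys₁ ++ ys₂))
length-++-∷ []        = refl
length-++-∷ (_ ∷ ys₁) = cong suc (length-++-∷ ys₁)

∈-++-∷⁻ : ∀ (ys₁ : List A) {x ys₂ z} → z ∈ ys₁ ++ x ∷ ys₂ → z ≢ x → z ∈ ys₁ ++ ys₂
∈-++-∷⁻ ys₁ z∈ z≢x with ∈-++⁻ ys₁ z∈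
... | inj₁ z∈ys₁   = ∈-++⁺ˡ z∈ys₁
... | inj₂ z∈x∷ys₂ = ∈-++⁺ʳ ys₁ (Any.tail z≢x z∈x∷ys₂)

Unique-⊆⇒length-≤ : ∀ {xs ys : List A} → Unique xs → xs ⊆ ys → length xs ≤ length ys
Unique-⊆⇒length-≤ []                          _     = z≤n
Unique-⊆⇒length-≤ {xs = x ∷ xs} (x∉xs ∷ xs!) xs⊆ys with ∈-∃++ (xs⊆ys (here refl))
... | ys₁ , ys₂ , refl =
  subst (suc (length xs) ≤_) (sym (length-++-∷ ys₁)) (s≤s (Unique-⊆⇒length-≤ xs! xs⊆ys₁++ys₂))
  where
  xs⊆ys₁++ys₂ : xs ⊆ ys₁ ++ ys₂
  xs⊆ys₁++ys₂ z∈xs =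
    ∈-++-∷⁻ ys₁ (xs⊆ys (there z∈xs)) (λ z≡x → All.lookup x∉xs z∈xs (sym z≡x))

Unique-⊆-length⇒⊇ : DecidableEquality A → ∀ {xs ys : List A} →
                    Unique xs → xs ⊆ ys → length ys ≤ length xs → ys ⊆ xs
Unique-⊆-length⇒⊇ _≟_ {xs} xs! xs⊆ys |ys|≤|xs| {y} y∈ys with Any.any? (y ≟_) xs
... | yes y∈xs = y∈xs
... | no  y∉xs with ∈-∃++ y∈ys
...   | ys₁ , ys₂ , refl =
  ⊥-elim (<⇒≱ (s≤s (Unique-⊆⇒length-≤ xs! xs⊆ys₁++ys₂))
              (subst (_≤ length xs) (length-++-∷ ys₁) |ys|≤|xs|))
  where
  xs⊆ys₁++ys₂ : xs ⊆ ys₁ ++ ys₂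
  xs⊆ys₁++ys₂ z∈xs = ∈-++-∷⁻ ys₁ (xs⊆ys z∈xs) (λ z≡y → y∉xs (subst (_∈ xs) z≡y z∈xs))

Σ-T-≡ : ∀ {P : A → Bool} {a b : A} {p : T (P a)} {q : T (P b)} → a ≡ b →
        _≡_ {A = Σ A (T ∘ P)} (a , p) (b , q)
Σ-T-≡ refl = cong (_ ,_) (T-irrelevant _ _)

T-not⇔¬T : ∀ {b} → T (not b) ⇔ (¬ T b)
T-not⇔¬T {false} = mk⇔ (λ _ ()) (λ _ → tt)
T-not⇔¬T {true}  = mk⇔ (λ ()) (λ ¬t → ¬t tt)

T-not-∨ : ∀ {x y} → T (not (x ∨ y)) ⇔ (T (not x) × T (not y))
T-not-∨ {false} = mk⇔ (tt ,_) proj₂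
T-not-∨ {true}  = mk⇔ (λ ()) (λ ())

T-not-any⇔All¬ : (p : A → Bool) (xs : List A) → T (not (any p xs)) ⇔ All (¬_ ∘ T ∘ p) xs
T-not-any⇔All¬ p xs = mk⇔
  (λ h → ¬Any⇒All¬ xs (to T-not⇔¬T h ∘ any⁺ p))
  (λ h → from T-not⇔¬T (All¬⇒¬Any h ∘ any⁻ p xs))

distinct⇔Unique : ∀ xs → T (distinct xs) ⇔ Unique xs
distinct⇔Unique []       = mk⇔ (λ _ → []) (λ _ → tt)
distinct⇔Unique (a ∷ xs) = mk⇔
  (λ h → let (fresh , rest) = to T-∧ h
         in All.map (λ ¬a≡b a≡b → ¬a≡b (≡⇒≡ᵇ a _ a≡b)) (to (T-not-any⇔All¬ _ xs) fresh)
            ∷ to (distinct⇔Unique xs) rest)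
  (λ where (fresh ∷ rest) → from T-∧
             ( from (T-not-any⇔All¬ _ xs) (All.map (λ a≢b a≡b → a≢b (≡ᵇ⇒≡ a _ a≡b)) fresh)
             , from (distinct⇔Unique xs) rest))

Avoids12Below : ℕ → List ℕ → Set
Avoids12Below a = AllPairs (λ b c → b < c → a ≤ c)

data Avoids312 : List ℕ → Set where
  []  : Avoids312 []
  _∷_ : ∀ {a xs} → Avoids12Below a xs → Avoids312 xs → Avoids312 (a ∷ xs)

Avoids312-head : ∀ {a xs} → Avoids312 (a ∷ xs) → Avoids12Below a xs
Avoids312-head (no12 ∷ _) = no12

Avoids312-tail : ∀ {a xs} → Avoids312 (a ∷ xs) → Avoids312 xs
Avoids312-tail (_ ∷ avoids) = avoids

avoids12Below-zero : ∀ xs → Avoids12Below 0 xs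
avoids12Below-zero []       = []
avoids12Below-zero (_ ∷ xs) = All.universal (λ _ _ → z≤n) xs ∷ avoids12Below-zero xs

pairs312⇔Avoids12Below : ∀ a xs → T (not (pairs312 a xs)) ⇔ Avoids12Below a xs
pairs312⇔Avoids12Below a []       = mk⇔ (λ _ → []) (λ _ → tt)
pairs312⇔Avoids12Below a (b ∷ ys) = mk⇔
  (λ h → let (fresh , rest) = to T-not-∨ h
         in All.map no12⁺ (to (T-not-any⇔All¬ _ ys) fresh) ∷ to (pairs312⇔Avoids12Below a ys) rest)
  (λ where (fresh ∷ rest) → from T-not-∨
             (from (T-not-any⇔All¬ _ ys) (All.map no12⁻ fresh) , from (pairs312⇔Avoids12Below a ys) rest))
  where
  no12⁺ : ∀ {c} → ¬ T ((b <ᵇ c) ∧ (c <ᵇ a)) → b < c → a ≤ c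
  no12⁺ ¬b<c<a b<c = ≮⇒≥ (λ c<a → ¬b<c<a (from T-∧ (<⇒<ᵇ b<c , <⇒<ᵇ c<a)))
  no12⁻ : ∀ {c} → (b < c → a ≤ c) → ¬ T ((b <ᵇ c) ∧ (c <ᵇ a))
  no12⁻ {c} h b<c<a = let (b<c , c<a) = to T-∧ b<c<a in <⇒≱ (<ᵇ⇒< c a c<a) (h (<ᵇ⇒< b c b<c))

contains312⇔Avoids312 : ∀ xs → T (not (contains312 xs)) ⇔ Avoids312 xs
contains312⇔Avoids312 []       = mk⇔ (λ _ → []) (λ _ → tt)
contains312⇔Avoids312 (a ∷ xs) = mk⇔
  (λ h → let (no12 , rest) = to T-not-∨ h
         in to (pairs312⇔Avoids12Below a xs) no12 ∷ to (contains312⇔Avoids312 xs) rest)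
  (λ where (no12 ∷ rest) → from T-not-∨
             (from (pairs312⇔Avoids12Below a xs) no12 , from (contains312⇔Avoids312 xs) rest))

DivisibleAscent : ℕ → ℕ → ℕ → Set
DivisibleAscent t a b = a < b → t ∣ b

ascentStep⇔DivisibleAscent : ∀ t a b → T (if a <ᵇ b then divides t b else true) ⇔ DivisibleAscent t a b
ascentStep⇔DivisibleAscent t a b with a <ᵇ b | <ᵇ-reflects-< a b
... | true  | ofʸ a<b = mk⇔ (λ t∣b _ → toWitness t∣b) (λ h → fromWitness (h a<b))
... | false | ofⁿ a≮b = mk⇔ (λ _ a<b → ⊥-elim (a≮b a<b)) (λ _ → tt)

ascentsRest⇔Linked : ∀ t a xs → T (ascentsRest t a xs) ⇔ Linked (DivisibleAscent t) (a ∷ xs)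
ascentsRest⇔Linked t a []       = mk⇔ (λ _ → [-]) (λ _ → tt)
ascentsRest⇔Linked t a (b ∷ xs) = mk⇔
  (λ h → let (step , rest) = to T-∧ h
         in to (ascentStep⇔DivisibleAscent t a b) step ∷ to (ascentsRest⇔Linked t b xs) rest)
  (λ where (step ∷ rest) → from T-∧
             (from (ascentStep⇔DivisibleAscent t a b) step , from (ascentsRest⇔Linked t b xs) rest))

ascentsMultiple⇔Linked : ∀ t xs → T (ascentsMultiple t xs) ⇔ Linked (DivisibleAscent t) (0 ∷ xs)
ascentsMultiple⇔Linked t []       = mk⇔ (λ _ → [-]) (λ _ → tt)
ascentsMultiple⇔Linked t (a ∷ xs) = mk⇔
  (λ h → let (t∣a , rest) = to T-∧ h in (λ _ → toWitness t∣a) ∷ to (ascentsRest⇔Linked t a xs) rest)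
  (λ where (step ∷ rest) → from T-∧
             (fromWitness (divisible step) , from (ascentsRest⇔Linked t a xs) rest))
  where
  divisible : ∀ {b} → DivisibleAscent t 0 b → t ∣ b
  divisible {zero}  _    = t ∣0
  divisible {suc _} step = step z<s

permutation-property⇔ : ∀ t xs → T (distinct xs ∧ not (contains312 xs) ∧ ascentsMultiple t xs)
                                ⇔ (Unique xs × Avoids312 xs × Linked (DivisibleAscent t) (0 ∷ xs))
permutation-property⇔ t xs = ⇔.trans T-∧
  (distinct⇔Unique xs ×-⇔ ⇔.trans T-∧ (contains312⇔Avoids312 xs ×-⇔ ascentsMultiple⇔Linked t xs))

data Walk (t N : ℕ) : ℕ → ℕ → List Step → Set where
  end   : Walk t N N N []
  east  : ∀ {x y s} → x ≤ y → Walk t N (suc x) y s → Walk t N x y (east ∷ s)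
  north : ∀ {x y s} → x ≤ y → Walk t N x (y + t) s → Walk t N x y (north ∷ s)

Walk-end : ∀ {t N x y} → x ≡ N → y ≡ N → Walk t N x y []
Walk-end refl refl = end

walk⇔Walk : ∀ t N x y s → T (walk t N x y s) ⇔ Walk t N x y s
walk⇔Walk t N x y [] = mk⇔
  (λ h → let (x≡N , y≡N) = to T-∧ (proj₂ (to (T-∧ {x ≤ᵇ y}) h))
         in Walk-end (≡ᵇ⇒≡ x N x≡N) (≡ᵇ⇒≡ y N y≡N))
  (λ where end → from T-∧ (≤⇒≤ᵇ (≤-refl {N}) , from T-∧ (≡⇒≡ᵇ N N refl , ≡⇒≡ᵇ N N refl)))
walk⇔Walk t N x y (east ∷ s) = mk⇔
  (λ h → let (x≤y , w) = to T-∧ h in east (≤ᵇ⇒≤ x y x≤y) (to (walk⇔Walk t N (suc x) y s) w))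
  (λ where (east x≤y w) → from T-∧ (≤⇒≤ᵇ x≤y , from (walk⇔Walk t N (suc x) y s) w))
walk⇔Walk t N x y (north ∷ s) = mk⇔
  (λ h → let (x≤y , w) = to T-∧ h in north (≤ᵇ⇒≤ x y x≤y) (to (walk⇔Walk t N x (y + t) s) w))
  (λ where (north x≤y w) → from T-∧ (≤⇒≤ᵇ x≤y , from (walk⇔Walk t N x (y + t) s) w))

module _ {t N : ℕ} where

  Walk-≤ : ∀ {x y s} → Walk t N x y s → x ≤ y
  Walk-≤ end           = ≤-refl
  Walk-≤ (east x≤y _)  = x≤y
  Walk-≤ (north x≤y _) = x≤y

  Walk-height-≤ : ∀ {x y s} → Walk t N x y s → y ≤ N
  Walk-height-≤ end                 = ≤-refl
  Walk-height-≤ (east _ w)          = Walk-height-≤ w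
  Walk-height-≤ {y = y} (north _ w) = ≤-trans (m≤m+n y t) (Walk-height-≤ w)

interval↓ : ℕ → ℕ → List ℕ
interval↓ M zero    = []
interval↓ M (suc k) = M + suc k ∷ interval↓ M k

module _ {M : ℕ} where

  ∈-interval↓⁻ : ∀ {k x} → x ∈ interval↓ M k → M < x × x ≤ M + k
  ∈-interval↓⁻ {suc k} (here refl) = m<m+n M z<s , ≤-refl
  ∈-interval↓⁻ {suc k} (there x∈) =
    let (M<x , x≤M+k) = ∈-interval↓⁻ x∈ in M<x , ≤-trans x≤M+k (+-monoʳ-≤ M (n≤1+n k))

  ∈-interval↓⁺ : ∀ {k x} → M < x → x ≤ M + k → x ∈ interval↓ M k
  ∈-interval↓⁺ {zero}      M<x x≤M+0 = ⊥-elim (<⇒≱ M<x (subst (_ ≤_) (+-identityʳ M) x≤M+0))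
  ∈-interval↓⁺ {suc k} {x} M<x x≤M+1+k with m≤n⇒m<n∨m≡n x≤M+1+k
  ... | inj₂ refl    = here refl
  ... | inj₁ x<M+1+k = there (∈-interval↓⁺ M<x (s≤s⁻¹ (subst (x <_) (+-suc M k) x<M+1+k)))

  interval↓-< : ∀ {k x} → x ∈ interval↓ M k → x < M + suc k
  interval↓-< {k} x∈ = ≤-<-trans (proj₂ (∈-interval↓⁻ x∈)) (+-monoʳ-< M (n<1+n k))

  length-interval↓ : ∀ k → length (interval↓ M k) ≡ k
  length-interval↓ zero    = refl
  length-interval↓ (suc k) = cong suc (length-interval↓ k)

  interval↓-decreasing : ∀ k → AllPairs _>_ (interval↓ M k)
  interval↓-decreasing zero    = []
  interval↓-decreasing (suc k) = All.tabulate interval↓-< ∷ interval↓-decreasing k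

interval↓-+ : ∀ M a b → interval↓ M (a + b) ≡ interval↓ (M + a) b ++ interval↓ M a
interval↓-+ M a zero    rewrite +-identityʳ a = refl
interval↓-+ M a (suc b) rewrite +-suc a b =
  cong₂ _∷_ (sym (trans (+-assoc M a (suc b)) (cong (M +_) (+-suc a b)))) (interval↓-+ M a b)

StackBelow : ℕ → List ℕ → Set
StackBelow M S = AllPairs _>_ S × All (_≤ M) S

module _ {M : ℕ} {S : List ℕ} where

  push-≤ : ∀ k → All (_≤ M) S → All (_≤ M + k) (interval↓ M k ++ S)
  push-≤ k S≤M =
    All.++⁺ (All.tabulate (proj₂ ∘ ∈-interval↓⁻)) (All.map (λ s≤M → ≤-trans s≤M (m≤m+n M k)) S≤M)

  push-< : ∀ k → All (_< M) S → All (_< M + suc k) (interval↓ M k ++ S)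
  push-< k S<M =
    All.++⁺ (All.tabulate interval↓-<) (All.map (λ s<M → <-≤-trans s<M (m≤m+n M (suc k))) S<M)

  push-decreasing : ∀ k → AllPairs _>_ S → All (_≤ M) S → AllPairs _>_ (interval↓ M k ++ S)
  push-decreasing k S-dec S≤M = AllPairs.++⁺ (interval↓-decreasing k) S-dec
    (All.tabulate (λ x∈ → All.map (λ s≤M → ≤-<-trans s≤M (proj₁ (∈-interval↓⁻ x∈))) S≤M))

  push-stack : ∀ k → StackBelow M S → StackBelow (M + k) (interval↓ M k ++ S)
  push-stack k (S-dec , S≤M) = push-decreasing k S-dec S≤M , push-≤ k S≤M

  length-push : ∀ {x} k → x + length S ≡ M → x + length (interval↓ M k ++ S) ≡ M + k
  length-push {x} k x+|S|≡M = begin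
    x + length (interval↓ M k ++ S)          ≡⟨ cong (x +_) (length-++ (interval↓ M k)) ⟩
    x + (length (interval↓ M k) + length S)  ≡⟨ cong (λ l → x + (l + length S)) (length-interval↓ k) ⟩
    x + (k + length S)                       ≡⟨ cong (x +_) (+-comm k (length S)) ⟩
    x + (length S + k)                       ≡⟨ +-assoc x (length S) k ⟨
    x + length S + k                         ≡⟨ cong (_+ k) x+|S|≡M ⟩
    M + k                                    ∎
    where open ≡-Reasoning

module Decoding (t : ℕ) where

  decode : ℕ → List ℕ → List Step → List ℕ
  decode M S       []          = []
  decode M S       (north ∷ p) = decode (M + t) (interval↓ M t ++ S) p
  decode M (s ∷ S) (east ∷ p)  = s ∷ decode M S p
  decode M []      (east ∷ p)  = decode M [] p

  ∈-decode : ∀ {M S v} p → v ∈ decode M S p → v ∈ S ⊎ M < v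
  ∈-decode {M} (north ∷ p) v∈ with ∈-decode p v∈
  ... | inj₂ M+t<v = inj₂ (≤-<-trans (m≤m+n M t) M+t<v)
  ... | inj₁ v∈I++S with ∈-++⁻ (interval↓ M t) v∈I++S
  ...   | inj₁ v∈I = inj₂ (proj₁ (∈-interval↓⁻ v∈I))
  ...   | inj₂ v∈S = inj₁ v∈S
  ∈-decode {S = s ∷ S} (east ∷ p) (here refl) = inj₁ (here refl)
  ∈-decode {S = s ∷ S} (east ∷ p) (there v∈) with ∈-decode p v∈
  ... | inj₁ v∈S = inj₁ (there v∈S)
  ... | inj₂ M<v = inj₂ M<v
  ∈-decode {S = []}    (east ∷ p) v∈          = ∈-decode p v∈

  ∈-decode-after-pop : ∀ {M s S v} p → All (_< s) S → v ∈ decode M S p → v < s ⊎ M < v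
  ∈-decode-after-pop p S<s v∈ with ∈-decode p v∈
  ... | inj₁ v∈S = inj₁ (All.lookup S<s v∈S)
  ... | inj₂ M<v = inj₂ M<v

  decode-unique : ∀ {M S} p → StackBelow M S → Unique (decode M S p)
  decode-unique []          _  = []
  decode-unique (north ∷ p) st = decode-unique p (push-stack t st)
  decode-unique {M} {s ∷ S} (east ∷ p) (S<s ∷ S-dec , s≤M ∷ S≤M) =
    All.tabulate (s≢v ∘ ∈-decode-after-pop p S<s) ∷ decode-unique p (S-dec , S≤M)
    where
    s≢v : ∀ {v} → v < s ⊎ M < v → s ≢ v
    s≢v (inj₁ v<s) refl = <-irrefl refl v<s
    s≢v (inj₂ M<v) refl = <⇒≱ M<v s≤M
  decode-unique {S = []} (east ∷ p) st = decode-unique p st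

  decode-avoids12Below : ∀ {M S a} p → a ≤ M → StackBelow M S → Avoids12Below a (decode M S p)
  decode-avoids12Below         []          _   _  = []
  decode-avoids12Below {M}     (north ∷ p) a≤M st =
    decode-avoids12Below p (≤-trans a≤M (m≤m+n M t)) (push-stack t st)
  decode-avoids12Below {M} {s ∷ S} {a} (east ∷ p) a≤M (S<s ∷ S-dec , s≤M ∷ S≤M) =
    All.tabulate (a≤v ∘ ∈-decode-after-pop p S<s) ∷ decode-avoids12Below p a≤M (S-dec , S≤M)
    where
    a≤v : ∀ {v} → v < s ⊎ M < v → s < v → a ≤ v
    a≤v (inj₁ v<s) s<v = ⊥-elim (<-asym s<v v<s)
    a≤v (inj₂ M<v) _   = ≤-trans a≤M (<⇒≤ M<v)
  decode-avoids12Below {S = []} (east ∷ p) a≤M st = decode-avoids12Below p a≤M st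

  decode-avoids312 : ∀ {M S} p → StackBelow M S → Avoids312 (decode M S p)
  decode-avoids312 []          _  = []
  decode-avoids312 (north ∷ p) st = decode-avoids312 p (push-stack t st)
  decode-avoids312 {S = s ∷ S} (east ∷ p) (S<s ∷ S-dec , s≤M ∷ S≤M) =
    decode-avoids12Below p s≤M (S-dec , S≤M) ∷ decode-avoids312 p (S-dec , S≤M)
  decode-avoids312 {S = []} (east ∷ p) st = decode-avoids312 p st

  AscentToTop : ℕ → List ℕ → Set
  AscentToTop a []      = ⊤
  AscentToTop a (s ∷ _) = DivisibleAscent t a s

  push-ascentToTop : ∀ {a M S} k → t ∣ M + k → AscentToTop a S → AscentToTop a (interval↓ M k ++ S)
  push-ascentToTop zero    _     top = top
  push-ascentToTop (suc k) t∣M+k _   = λ _ → t∣M+k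

  no-ascentToTop : ∀ {s S} → All (_< s) S → AscentToTop s S
  no-ascentToTop []          = tt
  no-ascentToTop (h<s ∷ _) s<h = ⊥-elim (<-asym s<h h<s)

  decode-ascents : ∀ {M S a} p → t ∣ M → StackBelow M S → AscentToTop a S →
                   Linked (DivisibleAscent t) (a ∷ decode M S p)
  decode-ascents []          _   _  _   = [-]
  decode-ascents (north ∷ p) t∣M st top =
    decode-ascents p t∣M+t (push-stack t st) (push-ascentToTop t t∣M+t top)
    where t∣M+t = ∣m∣n⇒∣m+n t∣M ∣-refl
  decode-ascents {S = s ∷ S} (east ∷ p) t∣M (S<s ∷ S-dec , S≤M) top =
    top ∷ decode-ascents p t∣M (S-dec , All.tail S≤M) (no-ascentToTop S<s)
  decode-ascents {S = []} (east ∷ p) t∣M st top = decode-ascents p t∣M st top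

  module _ {N : ℕ} where

    empty-stack-cannot-pop : ∀ {x M p} → Walk t N (suc x) M p → x + 0 ≢ M
    empty-stack-cannot-pop {x} w x+0≡M =
      <⇒≱ (Walk-≤ w) (≤-reflexive (trans (sym x+0≡M) (+-identityʳ x)))

    decode-length : ∀ {x M S} p → Walk t N x M p → x + length S ≡ M → x + length (decode M S p) ≡ N
    decode-length []          end         _  = +-identityʳ N
    decode-length (north ∷ p) (north _ w) eq = decode-length p w (length-push t eq)
    decode-length {x} {S = s ∷ S} (east ∷ p) (east _ w) eq =
      trans (+-suc x _) (decode-length p w (trans (sym (+-suc x _)) eq))
    decode-length {S = []} (east ∷ p) (east _ w) eq = ⊥-elim (empty-stack-cannot-pop w eq)

    decode-≤ : ∀ {x M S} p → Walk t N x M p → All (_≤ M) S → All (_≤ N) (decode M S p)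
    decode-≤ []          _           _   = []
    decode-≤ (north ∷ p) (north _ w) S≤M = decode-≤ p w (push-≤ t S≤M)
    decode-≤ {S = s ∷ S} (east ∷ p) (east _ w) (s≤M ∷ S≤M) =
      ≤-trans s≤M (Walk-height-≤ w) ∷ decode-≤ p w S≤M
    decode-≤ {S = []}    (east ∷ p) (east _ w) S≤M = decode-≤ p w S≤M

module Encoding (t′ N : ℕ) where

  t : ℕ
  t = suc t′

  open Decoding t

  -- M is the largest letter read so far.
  encode : ℕ → List ℕ → List Step
  encode M []       = []
  encode M (v ∷ vs) =
    if M <ᵇ v then replicate ((v ∸ M) / t) north ++ east ∷ encode v vs else east ∷ encode M vs

  climb-length : ∀ M k → (M + suc k * t ∸ M) / t ≡ suc k
  climb-length M k = trans (cong (_/ t) (m+n∸m≡n M (suc k * t))) (m*n/n≡m (suc k) t)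

  encode-climb : ∀ M k vs → encode M (M + suc k * t ∷ vs) ≡
                             replicate (suc k) north ++ east ∷ encode (M + suc k * t) vs
  encode-climb M k vs with M <ᵇ M + suc k * t | <ᵇ-reflects-< M (M + suc k * t)
  ... | true  | _       =
    cong (λ n → replicate n north ++ east ∷ encode (M + suc k * t) vs) (climb-length M k)
  ... | false | ofⁿ M≮ = ⊥-elim (M≮ (m<m+n M z<s))

  encode-stay : ∀ {M v} vs → v ≤ M → encode M (v ∷ vs) ≡ east ∷ encode M vs
  encode-stay {M} {v} vs v≤M with M <ᵇ v | <ᵇ-reflects-< M v
  ... | false | _       = refl
  ... | true  | ofʸ M<v = ⊥-elim (<⇒≱ M<v v≤M)

  interval↓-north : ∀ M₀ k S₀ →
    interval↓ (M₀ + k * t) t ++ (interval↓ M₀ (k * t) ++ S₀) ≡ interval↓ M₀ (suc k * t) ++ S₀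
  interval↓-north M₀ k S₀ = begin
    interval↓ (M₀ + k * t) t ++ (interval↓ M₀ (k * t) ++ S₀)
      ≡⟨ ++-assoc (interval↓ (M₀ + k * t) t) _ S₀ ⟨
    (interval↓ (M₀ + k * t) t ++ interval↓ M₀ (k * t)) ++ S₀
      ≡⟨ cong (_++ S₀) (interval↓-+ M₀ (k * t) t) ⟨
    interval↓ M₀ (k * t + t) ++ S₀
      ≡⟨ cong (λ n → interval↓ M₀ n ++ S₀) (+-comm (k * t) t) ⟩
    interval↓ M₀ (suc k * t) ++ S₀
      ∎
    where open ≡-Reasoning

  decode-norths : ∀ k M S q →
                  decode M S (replicate k north ++ q) ≡ decode (M + k * t) (interval↓ M (k * t) ++ S) q
  decode-norths zero    M S q rewrite +-identityʳ M = refl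
  decode-norths (suc k) M S q = begin
    decode (M + t) (interval↓ M t ++ S) (replicate k north ++ q)
      ≡⟨ decode-norths k (M + t) (interval↓ M t ++ S) q ⟩
    decode (M + t + k * t) (interval↓ (M + t) (k * t) ++ (interval↓ M t ++ S)) q
      ≡⟨ cong₂ (λ m S′ → decode m S′ q) (+-assoc M t (k * t))
               (sym (++-assoc (interval↓ (M + t) (k * t)) _ S)) ⟩
    decode (M + suc k * t) ((interval↓ (M + t) (k * t) ++ interval↓ M t) ++ S) q
      ≡⟨ cong (λ S′ → decode (M + suc k * t) (S′ ++ S) q) (interval↓-+ M t (k * t)) ⟨
    decode (M + suc k * t) (interval↓ M (suc k * t) ++ S) q
      ∎
    where open ≡-Reasoning

  walk-norths : ∀ k {x M q} → x ≤ M → Walk t N x (M + k * t) q → Walk t N x M (replicate k north ++ q)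
  walk-norths zero    {x} {M} {q} _   w = subst (λ m → Walk t N x m q) (+-identityʳ M) w
  walk-norths (suc k) {x} {M} {q} x≤M w = north x≤M (walk-norths k (≤-trans x≤M (m≤m+n M t)) w′)
    where w′ = subst (λ m → Walk t N x m q) (sym (+-assoc M t (k * t))) w

  -- The decoder may run k north steps ahead of the encoder, which has not yet climbed to the top k·t
  -- values on the stack.
  encode-decode : ∀ {x M} p k M₀ S₀ → M ≡ M₀ + k * t → All (_< M₀) S₀ → Walk t N x M p →
                  x + length (interval↓ M₀ (k * t) ++ S₀) ≡ M →
                  encode M₀ (decode M (interval↓ M₀ (k * t) ++ S₀) p) ≡ replicate k north ++ p
  encode-decode     []  zero    _ _ _ _ _   _   = refl
  encode-decode {x} []  (suc k) _ _ _ _ end len = ⊥-elim (m+1+n≢m x len)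
  encode-decode {x} (north ∷ p) k M₀ S₀ refl S₀<M₀ (north _ w) len rewrite interval↓-north M₀ k S₀ =
    trans (encode-decode p (suc k) M₀ S₀ height S₀<M₀ w len′) (replicate-suc-++ k north p)
    where
    height : M₀ + k * t + t ≡ M₀ + suc k * t
    height = trans (+-assoc M₀ (k * t) t) (cong (M₀ +_) (+-comm (k * t) t))
    len′ : x + length (interval↓ M₀ (suc k * t) ++ S₀) ≡ M₀ + k * t + t
    len′ = subst (λ S → x + length S ≡ M₀ + k * t + t) (interval↓-north M₀ k S₀) (length-push t len)
  encode-decode {x} {M} (east ∷ p) zero M₀ (s ∷ S₀) M≡ (s<M₀ ∷ S₀<M₀) (east _ w) len =
    trans (encode-stay (decode M S₀ p) (<⇒≤ s<M₀))
          (cong (east ∷_) (encode-decode p zero M₀ S₀ M≡ S₀<M₀ w (trans (sym (+-suc x _)) len)))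
  encode-decode (east ∷ p) zero M₀ [] _ _ (east _ w) len = ⊥-elim (empty-stack-cannot-pop w len)
  encode-decode {x} {M} (east ∷ p) (suc k) M₀ S₀ M≡ S₀<M₀ (east _ w) len =
    trans (encode-climb M₀ k (decode M S′ p))
          (cong (λ q → replicate (suc k) north ++ east ∷ q)
                (encode-decode p zero v S′ (trans M≡ (sym (+-identityʳ v))) (push-< d S₀<M₀) w
                               (trans (sym (+-suc x _)) len)))
    where
    d  = t′ + k * t
    v  = M₀ + suc d
    S′ = interval↓ M₀ d ++ S₀

  climb-height : ∀ {M v} → t ∣ M → t ∣ v → M < v → ∃ λ k → v ≡ M + suc k * t
  climb-height {M} {v} t∣M t∣v M<v
    with ∣m+n∣m⇒∣n (subst (t ∣_) (sym (m+[n∸m]≡n (<⇒≤ M<v))) t∣v) t∣M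
  ... | mk∣ zero    v∸M≡0   = ⊥-elim (<⇒≢ (m<n⇒0<n∸m M<v) (sym v∸M≡0))
  ... | mk∣ (suc k) v∸M≡k*t = k , trans (sym (m+[n∸m]≡n (<⇒≤ M<v))) (cong (M +_) v∸M≡k*t)

  -- Otherwise M, v, s would form a 312 pattern.
  top-of-stack : ∀ {M s S v vs} → All (_< s) S → s < M → s ∈ v ∷ vs → Avoids12Below M (v ∷ vs) →
                 v ∈ s ∷ S → v ≡ s
  top-of-stack _   _   _  _          (here v≡s)  = v≡s
  top-of-stack S<s s<M s∈ (no12 ∷ _) (there v∈S) with All.lookup S<s v∈S | s∈
  ... | v<s | here s≡v   = ⊥-elim (<⇒≢ v<s (sym s≡v))
  ... | v<s | there s∈vs = ⊥-elim (<⇒≱ s<M (All.lookup no12 s∈vs v<s))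

  -- The state of the encoder after reading prev as the x-th letter, with vs still to be read: M is the
  -- largest letter read so far and S the stack of the smaller letters not yet read.
  record Invariant (x M : ℕ) (S : List ℕ) (prev : ℕ) (vs : List ℕ) : Set where
    field
      stack-decreasing : AllPairs _>_ S
      stack<M          : All (_< M) S
      remaining        : ∀ {v} → v ∈ vs ⇔ (v ∈ S ⊎ M < v × v ≤ N)
      unique           : Unique vs
      avoids12Below    : Avoids12Below M vs
      avoids312        : Avoids312 vs
      t∣M              : t ∣ M
      prev≤M           : prev ≤ M
      ascents          : Linked (DivisibleAscent t) (prev ∷ vs)
      length-S         : x + length S ≡ M
      length-vs        : x + length vs ≡ N

    x≤M : x ≤ M
    x≤M = ≤-trans (m≤m+n x (length S)) (≤-reflexive length-S)

  invariant-after-pop : ∀ {x M S prev v vs} →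
                        Invariant x M (v ∷ S) prev (v ∷ vs) → Invariant (suc x) M S v vs
  invariant-after-pop {x} {M} {S} {prev} {v} {vs} I = record
    { stack-decreasing = AllPairs.tail stack-decreasing
    ; stack<M          = All.tail stack<M
    ; remaining        = mk⇔ forward backward
    ; unique           = AllPairs.tail unique
    ; avoids12Below    = AllPairs.tail avoids12Below
    ; avoids312        = Avoids312-tail avoids312
    ; t∣M              = t∣M
    ; prev≤M           = <⇒≤ v<M
    ; ascents          = Linked.tail ascents
    ; length-S         = trans (sym (+-suc x _)) length-S
    ; length-vs        = trans (sym (+-suc x _)) length-vs
    }
    where
    open Invariant I
    v<M : v < M
    v<M = All.head stack<M
    forward : ∀ {w} → w ∈ vs → w ∈ S ⊎ M < w × w ≤ N
    forward w∈vs with to remaining (there w∈vs)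
    ... | inj₁ (here refl) = ⊥-elim (All.lookup (AllPairs.head unique) w∈vs refl)
    ... | inj₁ (there w∈S) = inj₁ w∈S
    ... | inj₂ M<w≤N       = inj₂ M<w≤N
    backward : ∀ {w} → w ∈ S ⊎ M < w × w ≤ N → w ∈ vs
    backward (inj₁ w∈S) =
      Any.tail (<⇒≢ (All.lookup (AllPairs.head stack-decreasing) w∈S)) (from remaining (inj₁ (there w∈S)))
    backward (inj₂ (M<w , w≤N)) =
      Any.tail (>⇒≢ (<-trans v<M M<w)) (from remaining (inj₂ (M<w , w≤N)))

  invariant-after-climb : ∀ {x M S prev d vs} → t ∣ M + suc d → Invariant x M S prev (M + suc d ∷ vs) →
                          Invariant (suc x) (M + suc d) (interval↓ M d ++ S) (M + suc d) vs
  invariant-after-climb {x} {M} {S} {prev} {d} {vs} t∣v I = record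
    { stack-decreasing = push-decreasing d stack-decreasing (All.map <⇒≤ stack<M)
    ; stack<M          = push-< d stack<M
    ; remaining        = mk⇔ forward backward
    ; unique           = AllPairs.tail unique
    ; avoids12Below    = Avoids312-head avoids312
    ; avoids312        = Avoids312-tail avoids312
    ; t∣M              = t∣v
    ; prev≤M           = ≤-refl
    ; ascents          = Linked.tail ascents
    ; length-S         = trans (cong suc (length-push d length-S)) (sym (+-suc M d))
    ; length-vs        = trans (sym (+-suc x _)) length-vs
    }
    where
    open Invariant I
    v = M + suc d
    M<v : M < v
    M<v = m<m+n M z<s
    v≤N : v ≤ N
    v≤N with to remaining (here refl)
    ... | inj₁ v∈S       = ⊥-elim (<-asym M<v (All.lookup stack<M v∈S))
    ... | inj₂ (_ , v≤N) = v≤N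
    forward : ∀ {w} → w ∈ vs → w ∈ interval↓ M d ++ S ⊎ v < w × w ≤ N
    forward {w} w∈vs with to remaining (there w∈vs)
    ... | inj₁ w∈S = inj₁ (∈-++⁺ʳ (interval↓ M d) w∈S)
    ... | inj₂ (M<w , w≤N) with <-cmp w v
    ...   | tri< w<v _ _ = inj₁ (∈-++⁺ˡ (∈-interval↓⁺ M<w (s≤s⁻¹ (subst (w <_) (+-suc M d) w<v))))
    ...   | tri≈ _ w≡v _ = ⊥-elim (All.lookup (AllPairs.head unique) w∈vs (sym w≡v))
    ...   | tri> _ _ v<w = inj₂ (v<w , w≤N)
    backward : ∀ {w} → w ∈ interval↓ M d ++ S ⊎ v < w × w ≤ N → w ∈ vs
    backward (inj₂ (v<w , w≤N)) = Any.tail (>⇒≢ v<w) (from remaining (inj₂ (<-trans M<v v<w , w≤N)))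
    backward (inj₁ w∈I++S) with ∈-++⁻ (interval↓ M d) w∈I++S
    ... | inj₂ w∈S =
      Any.tail (<⇒≢ (<-trans (All.lookup stack<M w∈S) M<v)) (from remaining (inj₁ w∈S))
    ... | inj₁ w∈I =
      let w<v = interval↓-< w∈I
          w≤N = <⇒≤ (<-≤-trans w<v v≤N)
      in Any.tail (<⇒≢ w<v) (from remaining (inj₂ (proj₁ (∈-interval↓⁻ w∈I) , w≤N)))

  next-is-top : ∀ {x M S prev v vs} → Invariant x M S prev (v ∷ vs) → v ≤ M →
                ∃ λ S′ → S ≡ v ∷ S′
  next-is-top {S = []} I v≤M with to (Invariant.remaining I) (here refl)
  ... | inj₂ (M<v , _) = ⊥-elim (<⇒≱ M<v v≤M)
  next-is-top {S = s ∷ S′} I v≤M with to (Invariant.remaining I) (here refl)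
  ... | inj₂ (M<v , _) = ⊥-elim (<⇒≱ M<v v≤M)
  ... | inj₁ v∈S = S′ , cong (_∷ S′) (sym v≡s)
    where
    open Invariant I
    v≡s = top-of-stack (AllPairs.head stack-decreasing) (All.head stack<M)
                       (from remaining (inj₁ (here refl))) avoids12Below v∈S

  next-divisible : ∀ {x M S prev v vs} → Invariant x M S prev (v ∷ vs) → M < v → t ∣ v
  next-divisible I M<v = Linked.head ascents (≤-<-trans prev≤M M<v)
    where open Invariant I

  RoundTrip : ℕ → ℕ → List ℕ → List ℕ → Set
  RoundTrip x M S vs = Walk t N x M (encode M vs) × decode M S (encode M vs) ≡ vs

  round-trip-pop : ∀ {x M S v} vs → x ≤ M → v ≤ M →
                   RoundTrip (suc x) M S vs → RoundTrip x M (v ∷ S) (v ∷ vs)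
  round-trip-pop {v = v} vs x≤M v≤M (w , dec) rewrite encode-stay vs v≤M =
    east x≤M w , cong (v ∷_) dec

  round-trip-climb : ∀ {x M S} k vs → x ≤ M →
                     RoundTrip (suc x) (M + suc k * t) (interval↓ M (t′ + k * t) ++ S) vs →
                     RoundTrip x M S (M + suc k * t ∷ vs)
  round-trip-climb {x} {M} {S} k vs x≤M (w , dec) =
      subst (Walk t N x M) (sym (encode-climb M k vs))
            (walk-norths (suc k) x≤M (east (≤-trans x≤M (m≤m+n M _)) w))
    , (begin
        decode M S (encode M (v ∷ vs))
          ≡⟨ cong (decode M S) (encode-climb M k vs) ⟩
        decode M S (replicate (suc k) north ++ east ∷ encode v vs)
          ≡⟨ decode-norths (suc k) M S _ ⟩
        v ∷ decode v (interval↓ M (t′ + k * t) ++ S) (encode v vs)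
          ≡⟨ cong (v ∷_) dec ⟩
        v ∷ vs
          ∎)
    where
    open ≡-Reasoning
    v = M + suc k * t

  decode-encode : ∀ {x M S prev} vs → Invariant x M S prev vs → RoundTrip x M S vs
  decode-encode {x} {S = []} [] I =
    Walk-end (trans (sym (+-identityʳ x)) length-vs) (trans (sym length-S) length-vs) , refl
    where open Invariant I
  decode-encode {S = s ∷ _} [] I with from (Invariant.remaining I) (inj₁ (here refl))
  ... | ()
  decode-encode {M = M} (v ∷ vs) I with v ≤? M
  ... | yes v≤M with next-is-top I v≤M
  ...   | _ , refl = round-trip-pop vs (Invariant.x≤M I) v≤M (decode-encode vs (invariant-after-pop I))
  decode-encode {M = M} (v ∷ vs) I | no v≰M
    with climb-height (Invariant.t∣M I) (next-divisible I (≰⇒> v≰M)) (≰⇒> v≰M)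
  ... | k , refl = round-trip-climb k vs (Invariant.x≤M I)
                     (decode-encode vs (invariant-after-climb (next-divisible I (≰⇒> v≰M)) I))

module _ {N : ℕ} where

  valueOf : Fin N → ℕ
  valueOf i = suc (toℕ i)

  ∈-values⇒range : ∀ {n} (w : Vec (Fin N) n) {v} → v ∈ map valueOf (toList w) → 0 < v × v ≤ N
  ∈-values⇒range w v∈ with ∈-map⁻ valueOf v∈
  ... | i , _ , refl = z<s , toℕ<n i

  vectorOf : (xs : List ℕ) → All (λ v → 0 < v × v ≤ N) xs → Vec (Fin N) (length xs)
  vectorOf []           []                = Vec.[]
  vectorOf (suc u ∷ xs) ((_ , u<N) ∷ xs∈) = fromℕ< u<N Vec.∷ vectorOf xs xs∈

  values-vectorOf : ∀ xs (xs∈ : All (λ v → 0 < v × v ≤ N) xs) →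
                    map valueOf (toList (vectorOf xs xs∈)) ≡ xs
  values-vectorOf []           []                = refl
  values-vectorOf (suc u ∷ xs) ((_ , u<N) ∷ xs∈) =
    cong₂ _∷_ (cong suc (toℕ-fromℕ< u<N)) (values-vectorOf xs xs∈)

  values-injective : ∀ {n} {w w′ : Vec (Fin N) n} →
                     map valueOf (toList w) ≡ map valueOf (toList w′) → w ≡ w′
  values-injective {w = w} {w′} eq = trans (sym (cast-is-id refl w))
    (toList-injective refl w w′ (map-injective (toℕ-injective ∘ suc-injective) eq))

module Bijection (t′ n : ℕ) where

  N : ℕ
  N = suc t′ * n

  open Encoding t′ N
  open Decoding t

  PermutationProperty : List ℕ → Set
  PermutationProperty xs = Unique xs × Avoids312 xs × Linked (DivisibleAscent t) (0 ∷ xs)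

  initial-invariant : (w : Vec (Fin N) N) → PermutationProperty (values w) → Invariant 0 0 [] 0 (values w)
  initial-invariant w (uniq , avoids , ascents) = record
    { stack-decreasing = []
    ; stack<M          = []
    ; remaining        = mk⇔ (inj₂ ∘ ∈-values⇒range w) in-range⇒∈-values
    ; unique           = uniq
    ; avoids12Below    = avoids12Below-zero (values w)
    ; avoids312        = avoids
    ; t∣M              = t ∣0
    ; prev≤M           = z≤n
    ; ascents          = ascents
    ; length-S         = refl
    ; length-vs        = length-values
    }
    where
    length-values : length (values w) ≡ N
    length-values = trans (length-map valueOf (toList w)) (length-toList w)
    all-values : interval↓ 0 N ⊆ values w
    all-values = Unique-⊆-length⇒⊇ _≟_ uniq
      (λ v∈ → let (0<v , v≤N) = ∈-values⇒range w v∈ in ∈-interval↓⁺ 0<v v≤N)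
      (≤-reflexive (trans (length-interval↓ N) (sym length-values)))
    in-range⇒∈-values : ∀ {v} → v ∈ [] ⊎ 0 < v × v ≤ N → v ∈ values w
    in-range⇒∈-values (inj₂ (0<v , v≤N)) = all-values (∈-interval↓⁺ 0<v v≤N)

  module _ (w : Vec (Fin N) N)
           (pf : T (distinct (values w) ∧ not (contains312 (values w)) ∧ ascentsMultiple t (values w))) where

    encode-round-trip : RoundTrip 0 0 [] (values w)
    encode-round-trip =
      decode-encode (values w) (initial-invariant w (to (permutation-property⇔ t (values w)) pf))

  module _ {s} (w : Walk t N 0 0 s) where

    word : List ℕ
    word = decode 0 [] s

    word-range : All (λ v → 0 < v × v ≤ N) word
    word-range = All.tabulate (λ v∈ → positive (∈-decode s v∈) , All.lookup (decode-≤ s w []) v∈)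
      where
      positive : ∀ {v} → v ∈ [] ⊎ 0 < v → 0 < v
      positive (inj₂ 0<v) = 0<v

    permutationOf : Vec (Fin N) N
    permutationOf = cast (decode-length s w refl) (vectorOf word word-range)

    values-permutationOf : values permutationOf ≡ word
    values-permutationOf =
      trans (cong (map valueOf) (toList-cast _ (vectorOf word word-range))) (values-vectorOf word word-range)

    permutationOf-property : PermutationProperty (values permutationOf)
    permutationOf-property = subst PermutationProperty (sym values-permutationOf)
      (decode-unique s ([] , []) , decode-avoids312 s ([] , []) , decode-ascents s (t ∣0) ([] , []) tt)

  pathOf : Perm312Asc t n → TDyck t n
  pathOf (w , pf) = s , from (walk⇔Walk t N 0 0 s) (proj₁ (encode-round-trip w pf))
    where s = encode 0 (values w)

  permutationOfPath : TDyck t n → Perm312Asc t n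
  permutationOfPath (s , pf) = permutationOf w , from (permutation-property⇔ t _) (permutationOf-property w)
    where w = to (walk⇔Walk t N 0 0 s) pf

  pathOf-permutationOfPath : ∀ p → pathOf (permutationOfPath p) ≡ p
  pathOf-permutationOfPath (s , pf) =
    Σ-T-≡ (trans (cong (encode 0) (values-permutationOf w)) (encode-decode s 0 0 [] refl [] w refl))
    where w = to (walk⇔Walk t N 0 0 s) pf

  permutationOfPath-pathOf : ∀ p → permutationOfPath (pathOf p) ≡ p
  permutationOfPath-pathOf (w , pf) =
    Σ-T-≡ (values-injective (trans (values-permutationOf walk′) (proj₂ (encode-round-trip w pf))))
    where
    s     = encode 0 (values w)
    walk′ = to (walk⇔Walk t N 0 0 s) (from (walk⇔Walk t N 0 0 s) (proj₁ (encode-round-trip w pf)))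

mainTheorem5 : (n t : ℕ) → 1 ≤ n → 1 ≤ t → Perm312Asc t n ⤖ TDyck t n
mainTheorem5 n (suc t′) _ _ =
  ↔⇒⤖ (mk↔ₛ′ pathOf permutationOfPath pathOf-permutationOfPath permutationOfPath-pathOf)
  where open Bijection t′ n
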